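{- Let $G$ be a non-regular graph on $n$ vertices, let $u,v$ be vertices of $G$ with $d_G(u)<d_G(v)$, and let $R=V(G)\setminus\{u,v\}$. If $F_k(G)$ is regular for some $2\le k\le n-2$, then $d_R(u)=0$, i.e. $u$ has no neighbour in $R$.
   Context: All graphs are finite and simple; $d_G(w)$ is the degree of $w$ in $G$, and for $S\subseteq V(G)$, $d_S(w)$ is the number of neighbours of $w$ lying in $S$. For a graph $G=(V,E)$ on $n$ vertices and $1\le k<n$, the $k$-token graph $F_k(G)$ has as vertices the $k$-element subsets of $V$, with $A,B$ adjacent whenever $A\triangle B=\{a,b\}$ for some edge $ab$ of $G$. -}

module Defs where

open import Data.Bool using (Bool; true; false; T; _xor_)
open import Data.Bool.Properties using () renaming (_≟_ to _≟B_)
open import Data.Nat using (ℕ; zero; suc) renaming (_≟_ to _≟ℕ_)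
open import Data.Fin using (Fin; zero; suc)
open import Data.Fin.Properties using (any?)
open import Data.Fin.Subset using (Subset; ⁅_⁆; _∪_; ∣_∣)
open import Data.Vec using (Vec; []; _∷_; zipWith)
open import Data.Vec.Properties using (≡-dec)
open import Data.List using (List; []; _∷_; _++_; map; filter; length; allFin)
open import Data.Product using (Σ; ∃; _×_; _,_)
open import Data.Empty using (⊥)
open import Relation.Nullary using (Dec; yes; no; ¬_; _×-dec_)
open import Relation.Nullary.Decidable using (¬?)
open import Relation.Binary.PropositionalEquality using (_≡_)

record Graph (n : ℕ) : Set where
  field
    adj   : Fin n → Fin n → Bool
    sym   : ∀ a b → adj a b ≡ adj b a
    irrefl : ∀ a → adj a a ≡ false
open Graph public

Adj : ∀ {n} → Graph n → Fin n → Fin n → Set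
Adj G a b = T (adj G a b)

Adj? : ∀ {n} (G : Graph n) a b → Dec (Adj G a b)
Adj? G a b with adj G a b
... | true  = yes _
... | false = no (λ ())

deg : ∀ {n} → Graph n → Fin n → ℕ
deg G w = length (filter (Adj? G w) (allFin _))

degIn : ∀ {n} (G : Graph n) {P : Fin n → Set} → (∀ x → Dec (P x)) → Fin n → ℕ
degIn G P? w = length (filter (λ x → Adj? G w x ×-dec P? x) (allFin _))

Regular : ∀ {n} → Graph n → Set
Regular {n} G = ∃ λ r → ∀ (w : Fin n) → deg G w ≡ r

_△_ : ∀ {n} → Subset n → Subset n → Subset n
A △ B = zipWith _xor_ A B

allSubsets : (n : ℕ) → List (Subset n)
allSubsets zero    = [] ∷ []
allSubsets (suc n) = map (true ∷_) (allSubsets n) ++ map (false ∷_) (allSubsets n)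

TokAdj : ∀ {n} → Graph n → Subset n → Subset n → Set
TokAdj G A B = ∃ λ a → ∃ λ b → Adj G a b × (A △ B ≡ ⁅ a ⁆ ∪ ⁅ b ⁆)

TokAdj? : ∀ {n} (G : Graph n) A B → Dec (TokAdj G A B)
TokAdj? G A B = any? λ a → any? λ b → Adj? G a b ×-dec ≡-dec _≟B_ (A △ B) (⁅ a ⁆ ∪ ⁅ b ⁆)

tokDeg : ∀ {n} → Graph n → ℕ → Subset n → ℕ
tokDeg {n} G k A =
  length (filter (λ B → (∣ B ∣ ≟ℕ k) ×-dec TokAdj? G A B) (allSubsets n))

TokenRegular : ∀ {n} → Graph n → ℕ → Set
TokenRegular {n} G k =
  ∃ λ r → ∀ (A : Subset n) → ∣ A ∣ ≡ k → tokDeg G k A ≡ r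

-- In F_k(G) the degree of a k-set A is the number of edges of G leaving A.
-- Adding a vertex x ∉ S to S changes that cut by d(x) - 2 d_S(x), so if F_k(G)
-- is regular then every (k-1)-set S avoiding u and v satisfies
--   d(u) + 2 d_S(v) = d(v) + 2 d_S(u).
-- Writing [xy] for the indicator of the edge xy, comparing S with S - z + y
-- shows [uz] - [vz] = [uy] - [vy] for all z ∈ S and y ∉ S ∪ {u,v}. If u had a
-- neighbour w outside {u,v}, choose such an S through w: the constant is
-- 1 - [vw] ≥ 0, hence d_S(v) ≤ d_S(u), and the displayed identity contradicts
-- d(u) < d(v).

module Submission where

open import Defs renaming (sym to adj-sym)
open import Data.Bool using (Bool; true; false; not; _∧_; _∨_; _xor_)
open import Data.Bool.Properties
  using (T-≡; ∧-comm; ∧-zeroʳ; ∧-identityʳ; ∨-zeroʳ; xor-assoc; xor-same; xor-comm; xor-identityʳ; true-xor)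
  renaming (_≟_ to _≟ᵇ_)
open import Data.Empty using (⊥; ⊥-elim)
open import Data.Fin using (Fin; zero; suc)
open import Data.Fin.Properties using (_≟_; punchInᵢ≢i)
open import Data.Fin.Subset using (Subset; ⁅_⁆; _∪_; ∣_∣; _∈_; ⊤) renaming (⊥ to ∅)
open import Data.Fin.Subset.Properties using (∣⊥∣≡0; ∣⊤∣≡n; x∈⁅x⁆; x∈⁅y⁆⇒x≡y; x∈p∪q⁺; x∈p∪q⁻; ∪-comm)
open import Data.List using (List; []; _∷_; _++_; map; filter; length; tabulate; allFin)
open import Data.List.Properties using (map-++; map-∘; map-cong; map-tabulate; filter-none)
open import Data.List.Relation.Unary.All using (universal)
open import Data.Nat using (ℕ; zero; suc; _+_; _*_; _≤_; _<_; _∸_; z≤n; s≤s; s≤s⁻¹) renaming (_≟_ to _≟ℕ_)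
open import Data.Nat.ListAction using (sum)
open import Data.Nat.ListAction.Properties using (sum-++)
open import Data.Nat.Properties
  using (+-*-semiring; +-commutativeSemigroup; +-identityʳ; +-comm; +-assoc; +-cancelˡ-≡; +-cancelʳ-≡;
         +-cancelˡ-≤; +-cancelʳ-≤; +-mono-≤; +-monoʳ-≤; +-monoˡ-≤; +-mono-<-≤;
         *-zeroʳ; *-identityʳ; *-distribˡ-+; *-cancelˡ-≡; *-monoʳ-≤; <-irrefl; module ≤-Reasoning)
open import Algebra.Properties.CommutativeSemigroup +-commutativeSemigroup
  using (xy∙z≈xz∙y; xy∙z≈zy∙x; x∙yz≈xz∙y; interchange)
open import Algebra.Properties.Semiring.Sum +-*-semiring
  using (sum-syntax; sum-remove; sum-cong-≗; sum-replicate-zero; ∑-distrib-+) renaming (sum to ∑)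
open import Data.Product using (∃; ∃₂; _×_; _,_; proj₁; proj₂; map₁)
open import Data.Sum using (_⊎_; inj₁; inj₂; [_,_]′) renaming (map to ⊎-map)
open import Data.Vec using (Vec; []; _∷_; lookup; _[_]≔_)
import Data.Vec as Vec
open import Data.Vec.Functional using (Vector; removeAt)
open import Data.Vec.Properties
  using (≡-dec; lookup-zipWith; lookup∘update; lookup∘update′; lookup-replicate; tabulate∘lookup; tabulate-cong)
open import Function using (_∘_; id; case_of_; Equivalence)
open import Level using (0ℓ)
open import Relation.Binary.PropositionalEquality
open import Relation.Nullary using (Dec; yes; no; does; ¬_; _×-dec_)
open import Relation.Nullary.Decidable using (¬?; dec-true)
open import Relation.Unary using (Pred; Decidable)

-- Indicators and finite sums

𝟙 : Bool → ℕ
𝟙 true  = 1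
𝟙 false = 0

indicator : ∀ {P : Set} (P? : Dec P) {x} → (P → x ≡ 1) → (¬ P → x ≡ 0) → x ≡ 𝟙 (does P?)
indicator (yes p) x≡1 _ = x≡1 p
indicator (no ¬p) _ x≡0 = x≡0 ¬p

∑-zero : ∀ {n} (f : Vector ℕ n) → (∀ i → f i ≡ 0) → ∑[ i < n ] f i ≡ 0
∑-zero {n} f f≗0 = trans (sum-cong-≗ f≗0) (sum-replicate-zero n)

∑-single : ∀ {n} (f : Vector ℕ n) x → (∀ i → i ≢ x → f i ≡ 0) → ∑[ i < n ] f i ≡ f x
∑-single {suc n} f x f≗0 = begin
  ∑ f                      ≡⟨ sum-remove {i = x} f ⟩
  f x + ∑ (removeAt f x)   ≡⟨ cong (f x +_) (∑-zero _ (λ j → f≗0 _ (punchInᵢ≢i x j))) ⟩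
  f x + 0                  ≡⟨ +-identityʳ (f x) ⟩
  f x                      ∎
  where open ≡-Reasoning

∑-update : ∀ {n} (f g : Vector ℕ n) x → (∀ i → i ≢ x → f i ≡ g i) →
           ∑[ i < n ] f i + g x ≡ ∑[ i < n ] g i + f x
∑-update {suc n} f g x f≗g = begin
  ∑ f + g x                      ≡⟨ cong (_+ g x) (sum-remove {i = x} f) ⟩
  f x + ∑ (removeAt f x) + g x   ≡⟨ cong (λ s → f x + s + g x) (sum-cong-≗ (λ j → f≗g _ (punchInᵢ≢i x j))) ⟩
  f x + ∑ (removeAt g x) + g x   ≡⟨ xy∙z≈zy∙x (f x) _ (g x) ⟩
  g x + ∑ (removeAt g x) + f x   ≡⟨ cong (_+ f x) (sum-remove {i = x} g) ⟨
  ∑ g + f x                      ∎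
  where open ≡-Reasoning

∑-mono-≤ : ∀ {n} (f g : Vector ℕ n) → (∀ i → f i ≤ g i) → ∑[ i < n ] f i ≤ ∑[ i < n ] g i
∑-mono-≤ {zero}  f g f≤g = z≤n
∑-mono-≤ {suc n} f g f≤g = +-mono-≤ (f≤g zero) (∑-mono-≤ (f ∘ suc) (g ∘ suc) (f≤g ∘ suc))

∑∑-single : ∀ {m n} (f : Fin m → Fin n → ℕ) a₀ b₀ → (∀ a b → ¬ (a ≡ a₀ × b ≡ b₀) → f a b ≡ 0) →
            ∑[ a < m ] ∑[ b < n ] f a b ≡ f a₀ b₀
∑∑-single f a₀ b₀ f≗0 =
  trans (∑-single _ a₀ (λ a a≢a₀ → ∑-zero _ (λ b → f≗0 a b (a≢a₀ ∘ proj₁))))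
        (∑-single _ b₀ (λ b b≢b₀ → f≗0 a₀ b (b≢b₀ ∘ proj₂)))

𝟙≤1 : ∀ b → 𝟙 b ≤ 1
𝟙≤1 true  = s≤s z≤n
𝟙≤1 false = z≤n

cross-cancel : ∀ c r a b x y → c + a ≡ r + x → c + b ≡ r + y → a + y ≡ b + x
cross-cancel c r a b x y ca≡rx cb≡ry = +-cancelˡ-≡ c _ _ (begin
  c + (a + y)   ≡⟨ +-assoc c a y ⟨
  c + a + y     ≡⟨ cong (_+ y) ca≡rx ⟩
  r + x + y     ≡⟨ xy∙z≈xz∙y r x y ⟩
  r + y + x     ≡⟨ cong (_+ x) cb≡ry ⟨
  c + b + x     ≡⟨ +-assoc c b x ⟩
  c + (b + x)   ∎)
  where open ≡-Reasoning

exchange-≤ : ∀ {a b c d e} → a + 1 ≡ b + c → c ≤ 1 → a + d ≡ b + e → e ≤ d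
exchange-≤ {a} {b} {c} {d} {e} a+1≡b+c c≤1 a+d≡b+e = +-cancelˡ-≤ b e d (begin
  b + e   ≡⟨ a+d≡b+e ⟨
  a + d   ≤⟨ +-monoˡ-≤ d a≤b ⟩
  b + d   ∎)
  where
  open ≤-Reasoning
  a≤b : a ≤ b
  a≤b = +-cancelʳ-≤ 1 a b (begin
    a + 1   ≡⟨ a+1≡b+c ⟩
    b + c   ≤⟨ +-monoʳ-≤ b c≤1 ⟩
    b + 1   ∎)

length-filter≡sum : ∀ {A : Set} {P : Pred A 0ℓ} (P? : Decidable P) xs →
                    length (filter P? xs) ≡ sum (map (𝟙 ∘ does ∘ P?) xs)
length-filter≡sum P? []       = refl
length-filter≡sum P? (x ∷ xs) with does (P? x)
... | true  = cong suc (length-filter≡sum P? xs)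
... | false = length-filter≡sum P? xs

sum-map-cong : ∀ {A : Set} {f g : A → ℕ} → (∀ x → f x ≡ g x) → ∀ xs → sum (map f xs) ≡ sum (map g xs)
sum-map-cong f≗g xs = cong sum (map-cong f≗g xs)

sum-map-zero : ∀ {A : Set} (xs : List A) → sum (map (λ _ → 0) xs) ≡ 0
sum-map-zero []       = refl
sum-map-zero (x ∷ xs) = sum-map-zero xs

sum-map-* : ∀ {A : Set} c (f : A → ℕ) xs → sum (map (λ x → c * f x) xs) ≡ c * sum (map f xs)
sum-map-* c f []       = sym (*-zeroʳ c)
sum-map-* c f (x ∷ xs) = trans (cong (c * f x +_) (sum-map-* c f xs)) (sym (*-distribˡ-+ c (f x) _))

sum-map-∑ : ∀ {A : Set} {m} (f : A → Vector ℕ m) xs →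
            sum (map (λ x → ∑[ i < m ] f x i) xs) ≡ ∑[ i < m ] sum (map (λ x → f x i) xs)
sum-map-∑ {m = m} f [] = sym (∑-zero {m} (λ _ → 0) (λ _ → refl))
sum-map-∑ f (x ∷ xs) = trans (cong (∑ (f x) +_) (sum-map-∑ f xs)) (sym (∑-distrib-+ (f x) _))

sum-tabulate : ∀ {n} (f : Vector ℕ n) → sum (tabulate f) ≡ ∑[ i < n ] f i
sum-tabulate {zero}  f = refl
sum-tabulate {suc n} f = cong (f zero +_) (sum-tabulate (f ∘ suc))

length-filter-allFin : ∀ {n} {P : Pred (Fin n) 0ℓ} (P? : Decidable P) →
                       length (filter P? (allFin n)) ≡ ∑[ i < n ] 𝟙 (does (P? i))
length-filter-allFin {n} P? = begin
  length (filter P? (allFin n))         ≡⟨ length-filter≡sum P? (allFin n) ⟩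
  sum (map (𝟙 ∘ does ∘ P?) (allFin n))  ≡⟨ cong sum (map-tabulate id (𝟙 ∘ does ∘ P?)) ⟩
  sum (tabulate (𝟙 ∘ does ∘ P?))        ≡⟨ sum-tabulate (𝟙 ∘ does ∘ P?) ⟩
  ∑[ i < n ] 𝟙 (does (P? i))            ∎
  where open ≡-Reasoning

-- Subsets of Fin n as Boolean vectors

infix 4 _≟ˢ_
_≟ˢ_ : ∀ {n} (A B : Subset n) → Dec (A ≡ B)
_≟ˢ_ = ≡-dec _≟ᵇ_

∑ˢ : ∀ {n} → (Subset n → ℕ) → ℕ
∑ˢ {n} g = sum (map g (allSubsets n))

∑ˢ-suc : ∀ {n} (g : Subset (suc n) → ℕ) → ∑ˢ g ≡ ∑ˢ (g ∘ (true ∷_)) + ∑ˢ (g ∘ (false ∷_))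
∑ˢ-suc {n} g = begin
  sum (map g (S₁ ++ S₀))              ≡⟨ cong sum (map-++ g S₁ S₀) ⟩
  sum (map g S₁ ++ map g S₀)          ≡⟨ sum-++ (map g S₁) (map g S₀) ⟩
  sum (map g S₁) + sum (map g S₀)     ≡⟨ cong₂ (λ xs ys → sum xs + sum ys) (map-∘ S) (map-∘ S) ⟨
  ∑ˢ (g ∘ (true ∷_)) + ∑ˢ (g ∘ (false ∷_)) ∎
  where
  open ≡-Reasoning
  S : List (Subset n)
  S = allSubsets n
  S₁ : List (Subset (suc n))
  S₁ = map (true ∷_) S
  S₀ : List (Subset (suc n))
  S₀ = map (false ∷_) S

∑ˢ-≟ˢ≡1 : ∀ {n} (X : Subset n) → ∑ˢ (λ B → 𝟙 (does (B ≟ˢ X))) ≡ 1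
∑ˢ-≟ˢ≡1 []          = refl
∑ˢ-≟ˢ≡1 {suc n} (true ∷ X)  =
  trans (∑ˢ-suc (λ B → 𝟙 (does (B ≟ˢ (true ∷ X))))) (cong₂ _+_ (∑ˢ-≟ˢ≡1 X) (sum-map-zero (allSubsets n)))
∑ˢ-≟ˢ≡1 {suc n} (false ∷ X) =
  trans (∑ˢ-suc (λ B → 𝟙 (does (B ≟ˢ (false ∷ X))))) (cong₂ _+_ (sum-map-zero (allSubsets n)) (∑ˢ-≟ˢ≡1 X))

lookup-ext : ∀ {A : Set} {n} {xs ys : Vec A n} → (∀ i → lookup xs i ≡ lookup ys i) → xs ≡ ys
lookup-ext {xs = xs} {ys} eq = begin
  xs                     ≡⟨ tabulate∘lookup xs ⟨
  Vec.tabulate (lookup xs) ≡⟨ tabulate-cong eq ⟩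
  Vec.tabulate (lookup ys) ≡⟨ tabulate∘lookup ys ⟩
  ys                     ∎
  where open ≡-Reasoning

lookup-⁅⁆ : ∀ {n} (a i : Fin n) → lookup ⁅ a ⁆ i ≡ does (i ≟ a)
lookup-⁅⁆ zero    zero    = refl
lookup-⁅⁆ zero    (suc i) = lookup-replicate i false
lookup-⁅⁆ (suc a) zero    = refl
lookup-⁅⁆ (suc a) (suc i) = lookup-⁅⁆ a i

△-cancelˡ : ∀ {n} (A D : Subset n) → A △ (A △ D) ≡ D
△-cancelˡ A D = lookup-ext λ i → begin
  lookup (A △ (A △ D)) i                    ≡⟨ lookup-zipWith _xor_ i A (A △ D) ⟩
  lookup A i xor lookup (A △ D) i           ≡⟨ cong (lookup A i xor_) (lookup-zipWith _xor_ i A D) ⟩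
  lookup A i xor (lookup A i xor lookup D i) ≡⟨ xor-assoc (lookup A i) _ _ ⟨
  (lookup A i xor lookup A i) xor lookup D i ≡⟨ cong (_xor lookup D i) (xor-same (lookup A i)) ⟩
  lookup D i                                ∎
  where open ≡-Reasoning

∣update∣ : ∀ {n} (S : Subset n) x t → ∣ S [ x ]≔ t ∣ + 𝟙 (lookup S x) ≡ ∣ S ∣ + 𝟙 t
∣update∣ (true  ∷ S) zero    true  = refl
∣update∣ (true  ∷ S) zero    false = trans (+-comm ∣ S ∣ 1) (sym (+-identityʳ _))
∣update∣ (false ∷ S) zero    true  = trans (+-identityʳ _) (+-comm 1 ∣ S ∣)
∣update∣ (false ∷ S) zero    false = refl
∣update∣ (true  ∷ S) (suc x) t     = cong suc (∣update∣ S x t)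
∣update∣ (false ∷ S) (suc x) t     = ∣update∣ S x t

∣insert∣ : ∀ {n} (S : Subset n) {x} → lookup S x ≡ false → ∣ S [ x ]≔ true ∣ ≡ suc ∣ S ∣
∣insert∣ S {x} x∉S = trans (sym (+-identityʳ _)) (trans (cong (λ s → ∣ S [ x ]≔ true ∣ + 𝟙 s) (sym x∉S))
                                                     (trans (∣update∣ S x true) (+-comm ∣ S ∣ 1)))

∣remove∣ : ∀ {n} (S : Subset n) {x} → lookup S x ≡ true → suc ∣ S [ x ]≔ false ∣ ≡ ∣ S ∣
∣remove∣ S {x} x∈S = trans (+-comm 1 _) (trans (cong (λ s → ∣ S [ x ]≔ false ∣ + 𝟙 s) (sym x∈S))
                                               (trans (∣update∣ S x false) (+-identityʳ ∣ S ∣)))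

△-pair : ∀ {n} (A : Subset n) {a b} → a ≢ b →
         A △ (⁅ a ⁆ ∪ ⁅ b ⁆) ≡ A [ a ]≔ not (lookup A a) [ b ]≔ not (lookup A b)
△-pair {n} A {a} {b} a≢b = lookup-ext pointwise
  where
  A′ : Subset n
  A′ = A [ a ]≔ not (lookup A a)
  flipped : ∀ x → x xor true ≡ not x
  flipped x = trans (xor-comm x true) (true-xor x)
  pointwise : ∀ i → lookup (A △ (⁅ a ⁆ ∪ ⁅ b ⁆)) i ≡ lookup (A′ [ b ]≔ not (lookup A b)) i
  pointwise i
    rewrite lookup-zipWith _xor_ i A (⁅ a ⁆ ∪ ⁅ b ⁆) | lookup-zipWith _∨_ i ⁅ a ⁆ ⁅ b ⁆
          | lookup-⁅⁆ a i | lookup-⁅⁆ b i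
    with i ≟ a | i ≟ b
  ... | _        | yes refl = begin
    lookup A i xor (_ ∨ true) ≡⟨ cong (lookup A i xor_) (∨-zeroʳ _) ⟩
    lookup A i xor true       ≡⟨ flipped (lookup A i) ⟩
    not (lookup A i)          ≡⟨ lookup∘update i A′ _ ⟨
    lookup (A′ [ i ]≔ not (lookup A i)) i ∎
    where open ≡-Reasoning
  ... | yes refl | no i≢b   = begin
    lookup A i xor true       ≡⟨ flipped (lookup A i) ⟩
    not (lookup A i)          ≡⟨ lookup∘update i A _ ⟨
    lookup A′ i               ≡⟨ lookup∘update′ i≢b A′ _ ⟨
    lookup (A′ [ b ]≔ _) i    ∎
    where open ≡-Reasoning
  ... | no i≢a   | no i≢b   = begin
    lookup A i xor false      ≡⟨ xor-identityʳ (lookup A i) ⟩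
    lookup A i                ≡⟨ lookup∘update′ i≢a A _ ⟨
    lookup A′ i               ≡⟨ lookup∘update′ i≢b A′ _ ⟨
    lookup (A′ [ b ]≔ _) i    ∎
    where open ≡-Reasoning

∣△-pair∣ : ∀ {n} (A : Subset n) {a b} → a ≢ b →
  ∣ A △ (⁅ a ⁆ ∪ ⁅ b ⁆) ∣ + (𝟙 (lookup A a) + 𝟙 (lookup A b)) ≡ ∣ A ∣ + (𝟙 (not (lookup A a)) + 𝟙 (not (lookup A b)))
∣△-pair∣ {n} A {a} {b} a≢b = begin
  ∣ A △ (⁅ a ⁆ ∪ ⁅ b ⁆) ∣ + (𝟙 (lookup A a) + 𝟙 (lookup A b))
    ≡⟨ cong (λ X → ∣ X ∣ + (𝟙 (lookup A a) + 𝟙 (lookup A b))) (△-pair A a≢b) ⟩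
  ∣ A′ [ b ]≔ not (lookup A b) ∣ + (𝟙 (lookup A a) + 𝟙 (lookup A b))
    ≡⟨ cong (λ s → ∣ A′ [ b ]≔ not (lookup A b) ∣ + (𝟙 (lookup A a) + 𝟙 s)) (lookup∘update′ (a≢b ∘ sym) A _) ⟨
  ∣ A′ [ b ]≔ not (lookup A b) ∣ + (𝟙 (lookup A a) + 𝟙 (lookup A′ b))
    ≡⟨ x∙yz≈xz∙y ∣ A′ [ b ]≔ not (lookup A b) ∣ _ _ ⟩
  ∣ A′ [ b ]≔ not (lookup A b) ∣ + 𝟙 (lookup A′ b) + 𝟙 (lookup A a)
    ≡⟨ cong (_+ 𝟙 (lookup A a)) (∣update∣ A′ b _) ⟩
  ∣ A′ ∣ + 𝟙 (not (lookup A b)) + 𝟙 (lookup A a)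
    ≡⟨ xy∙z≈xz∙y ∣ A′ ∣ _ _ ⟨
  ∣ A′ ∣ + 𝟙 (lookup A a) + 𝟙 (not (lookup A b))
    ≡⟨ cong (_+ 𝟙 (not (lookup A b))) (∣update∣ A a _) ⟩
  ∣ A ∣ + 𝟙 (not (lookup A a)) + 𝟙 (not (lookup A b))
    ≡⟨ +-assoc ∣ A ∣ _ _ ⟩
  ∣ A ∣ + (𝟙 (not (lookup A a)) + 𝟙 (not (lookup A b))) ∎
  where
  open ≡-Reasoning
  A′ : Subset n
  A′ = A [ a ]≔ not (lookup A a)

∉-∈⇒≢ : ∀ {n} (S : Subset n) {x z} → lookup S x ≡ false → lookup S z ≡ true → x ≢ z
∉-∈⇒≢ S x∉S z∈S x≡z with trans (sym x∉S) (trans (cong (lookup S) x≡z) z∈S)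
... | ()

∉-remove : ∀ {n} (S : Subset n) {x z} → lookup S x ≡ false → lookup S z ≡ true → lookup (S [ z ]≔ false) x ≡ false
∉-remove S x∉S z∈S = trans (lookup∘update′ (∉-∈⇒≢ S x∉S z∈S) S false) x∉S

choose-subset : ∀ {n} (M : Subset n) m → m < ∣ M ∣ →
  ∃ λ U → (∀ i → lookup U i ≡ true → lookup M i ≡ true) × ∣ U ∣ ≡ m × ∃ λ y → lookup M y ≡ true × lookup U y ≡ false
choose-subset (false ∷ M) m m<∣M∣ with choose-subset M m m<∣M∣
... | U , U⊆M , ∣U∣≡m , y , y∈M , y∉U = false ∷ U , (λ { (suc i) → U⊆M i }) , ∣U∣≡m , suc y , y∈M , y∉U
choose-subset {suc n} (true ∷ M) zero _ =
  ∅ , (λ i i∈∅ → case trans (sym (lookup-replicate i false)) i∈∅ of λ ()) , ∣⊥∣≡0 (suc n) , zero , refl , refl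
choose-subset (true ∷ M) (suc m) (s≤s m<∣M∣) with choose-subset M m m<∣M∣
... | U , U⊆M , ∣U∣≡m , y , y∈M , y∉U =
  true ∷ U , (λ { zero _ → refl ; (suc i) → U⊆M i }) , cong suc ∣U∣≡m , suc y , y∈M , y∉U

∉-⊆ : ∀ {n} {U M : Subset n} → (∀ i → lookup U i ≡ true → lookup M i ≡ true) →
      ∀ {x} → lookup M x ≡ false → lookup U x ≡ false
∉-⊆ {U = U} U⊆M {x} x∉M with lookup U x in x∈U
... | true  = case trans (sym (U⊆M x x∈U)) x∉M of λ ()
... | false = refl

module _ {n} {u v w : Fin n} (u≢v : u ≢ v) (w≢u : w ≢ u) (w≢v : w ≢ v) where

  private
    M₁ M₂ M : Subset n
    M₁ = ⊤ [ u ]≔ false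
    M₂ = M₁ [ v ]≔ false
    M = M₂ [ w ]≔ false

    ∣M∣+3≡n : suc (suc (suc ∣ M ∣)) ≡ n
    ∣M∣+3≡n = begin
      suc (suc (suc ∣ M ∣)) ≡⟨ cong (2 +_) (∣remove∣ M₂ {w} w∈M₂) ⟩
      suc (suc ∣ M₂ ∣)      ≡⟨ cong suc (∣remove∣ M₁ {v} v∈M₁) ⟩
      suc ∣ M₁ ∣            ≡⟨ ∣remove∣ (⊤ {n}) {u} (lookup-replicate u true) ⟩
      ∣ ⊤ {n} ∣             ≡⟨ ∣⊤∣≡n n ⟩
      n                     ∎
      where
      open ≡-Reasoning
      v∈M₁ : lookup M₁ v ≡ true
      v∈M₁ = trans (lookup∘update′ (u≢v ∘ sym) ⊤ false) (lookup-replicate v true)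
      w∈M₂ : lookup M₂ w ≡ true
      w∈M₂ = trans (lookup∘update′ w≢v M₁ false) (trans (lookup∘update′ w≢u ⊤ false) (lookup-replicate w true))

    u∉M : lookup M u ≡ false
    u∉M = trans (lookup∘update′ (w≢u ∘ sym) M₂ false) (trans (lookup∘update′ u≢v M₁ false) (lookup∘update u ⊤ false))

    v∉M : lookup M v ≡ false
    v∉M = trans (lookup∘update′ (w≢v ∘ sym) M₂ false) (lookup∘update v M₁ false)

    w∉M : lookup M w ≡ false
    w∉M = lookup∘update w M₂ false

  choose-configuration : ∀ m → 2 + m ≤ n ∸ 2 →
    ∃₂ λ T y → ∣ T ∣ ≡ suc m × lookup T u ≡ false × lookup T v ≡ false × lookup T w ≡ true ×
               lookup T y ≡ false × y ≢ u × y ≢ v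
  choose-configuration m m+4≤n with choose-subset M m (s≤s⁻¹ (subst (λ l → 2 + m ≤ l ∸ 2) (sym ∣M∣+3≡n) m+4≤n))
  ... | U , U⊆M , ∣U∣≡m , y , y∈M , y∉U =
    U [ w ]≔ true , y , trans (∣insert∣ U (∉-⊆ {U = U} {M} U⊆M {w} w∉M)) (cong suc ∣U∣≡m) ,
    outside u∉M (w≢u ∘ sym) , outside v∉M (w≢v ∘ sym) , lookup∘update w U true ,
    trans (lookup∘update′ (∉-∈⇒≢ M {w} {y} w∉M y∈M ∘ sym) U true) y∉U ,
    ∉-∈⇒≢ M {u} {y} u∉M y∈M ∘ sym , ∉-∈⇒≢ M {v} {y} v∉M y∈M ∘ sym
    where
    outside : ∀ {x} → lookup M x ≡ false → x ≢ w → lookup (U [ w ]≔ true) x ≡ false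
    outside x∉M x≢w = trans (lookup∘update′ x≢w U true) (∉-⊆ {U = U} {M} U⊆M x∉M)

-- Degrees into a set and the cut of a set

module _ {n} (G : Graph n) where

  does-Adj? : ∀ a b → does (Adj? G a b) ≡ adj G a b
  does-Adj? a b with adj G a b
  ... | true  = refl
  ... | false = refl

  deg≡∑ : ∀ x → deg G x ≡ ∑[ b < n ] 𝟙 (adj G x b)
  deg≡∑ x = trans (length-filter-allFin (Adj? G x)) (sum-cong-≗ (λ b → cong 𝟙 (does-Adj? x b)))

  degInto : Subset n → Fin n → ℕ
  degInto S x = ∑[ b < n ] 𝟙 (adj G x b ∧ lookup S b)

  leaves : Subset n → Fin n → Fin n → Bool
  leaves S a b = lookup S a ∧ not (lookup S b) ∧ adj G a b

  cut : Subset n → ℕ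
  cut S = ∑[ a < n ] ∑[ b < n ] 𝟙 (leaves S a b)

  degInto-update : ∀ S x y t →
    degInto (S [ y ]≔ t) x + 𝟙 (adj G x y ∧ lookup S y) ≡ degInto S x + 𝟙 (adj G x y ∧ t)
  degInto-update S x y t =
    trans (∑-update (λ b → 𝟙 (adj G x b ∧ lookup (S [ y ]≔ t) b)) (λ b → 𝟙 (adj G x b ∧ lookup S b)) y
                    (λ b b≢y → cong (λ s → 𝟙 (adj G x b ∧ s)) (lookup∘update′ b≢y S t)))
          (cong (λ s → degInto S x + 𝟙 (adj G x y ∧ s)) (lookup∘update y S t))

  degInto-insert : ∀ S x {y} → lookup S y ≡ false → degInto (S [ y ]≔ true) x ≡ degInto S x + 𝟙 (adj G x y)
  degInto-insert S x {y} y∉S = begin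
    d′                           ≡⟨ +-identityʳ d′ ⟨
    d′ + 𝟙 false                 ≡⟨ cong (λ s → d′ + 𝟙 s) (trans (cong (e ∧_) y∉S) (∧-zeroʳ e)) ⟨
    d′ + 𝟙 (e ∧ lookup S y)      ≡⟨ degInto-update S x y true ⟩
    degInto S x + 𝟙 (e ∧ true)   ≡⟨ cong (λ s → degInto S x + 𝟙 s) (∧-identityʳ e) ⟩
    degInto S x + 𝟙 e            ∎
    where
    open ≡-Reasoning
    d′ : ℕ
    d′ = degInto (S [ y ]≔ true) x
    e : Bool
    e = adj G x y

  degInto-remove : ∀ S x {z} → lookup S z ≡ true → degInto (S [ z ]≔ false) x + 𝟙 (adj G x z) ≡ degInto S x
  degInto-remove S x {z} z∈S = begin
    d′ + 𝟙 e                     ≡⟨ cong (λ s → d′ + 𝟙 s) (trans (cong (e ∧_) z∈S) (∧-identityʳ e)) ⟨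
    d′ + 𝟙 (e ∧ lookup S z)      ≡⟨ degInto-update S x z false ⟩
    degInto S x + 𝟙 (e ∧ false)  ≡⟨ cong (λ s → degInto S x + 𝟙 s) (∧-zeroʳ e) ⟩
    degInto S x + 0              ≡⟨ +-identityʳ (degInto S x) ⟩
    degInto S x                  ∎
    where
    open ≡-Reasoning
    d′ : ℕ
    d′ = degInto (S [ z ]≔ false) x
    e : Bool
    e = adj G x z

  leavesFrom : Subset n → Fin n → ℕ
  leavesFrom S a = ∑[ b < n ] 𝟙 (leaves S a b)

  module _ (S : Subset n) (x : Fin n) (x∉S : lookup S x ≡ false) where

    private
      S′ : Subset n
      S′ = S [ x ]≔ true

    leavesFrom-insert : ∀ a → a ≢ x → leavesFrom S′ a + 𝟙 (lookup S a ∧ adj G a x) ≡ leavesFrom S a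
    leavesFrom-insert a a≢x = begin
      leavesFrom S′ a + 𝟙 (lookup S a ∧ adj G a x)
        ≡⟨ cong (λ s → leavesFrom S′ a + 𝟙 (lookup S a ∧ not s ∧ adj G a x)) x∉S ⟨
      leavesFrom S′ a + 𝟙 (leaves S a x)
        ≡⟨ ∑-update (λ b → 𝟙 (leaves S′ a b)) (λ b → 𝟙 (leaves S a b)) x same-off-x ⟩
      leavesFrom S a + 𝟙 (leaves S′ a x)
        ≡⟨ cong (λ s → leavesFrom S a + 𝟙 (lookup S′ a ∧ not s ∧ adj G a x)) (lookup∘update x S true) ⟩
      leavesFrom S a + 𝟙 (lookup S′ a ∧ false)
        ≡⟨ cong (λ s → leavesFrom S a + 𝟙 s) (∧-zeroʳ (lookup S′ a)) ⟩
      leavesFrom S a + 0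
        ≡⟨ +-identityʳ (leavesFrom S a) ⟩
      leavesFrom S a ∎
      where
      open ≡-Reasoning
      same-off-x : ∀ b → b ≢ x → 𝟙 (leaves S′ a b) ≡ 𝟙 (leaves S a b)
      same-off-x b b≢x = cong₂ (λ s t → 𝟙 (s ∧ not t ∧ adj G a b))
                               (lookup∘update′ a≢x S true) (lookup∘update′ b≢x S true)

    leavesFrom-outside : leavesFrom S x ≡ 0
    leavesFrom-outside = ∑-zero _ (λ b → cong (λ s → 𝟙 (s ∧ not (lookup S b) ∧ adj G x b)) x∉S)

    leavesFrom-inserted : leavesFrom S′ x + degInto S x ≡ deg G x
    leavesFrom-inserted = begin
      leavesFrom S′ x + degInto S x
        ≡⟨ cong (leavesFrom S′ x +_) degInto-unchanged ⟨
      leavesFrom S′ x + degInto S′ x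
        ≡⟨ ∑-distrib-+ (λ b → 𝟙 (leaves S′ x b)) (λ b → 𝟙 (adj G x b ∧ lookup S′ b)) ⟨
      ∑[ b < n ] (𝟙 (leaves S′ x b) + 𝟙 (adj G x b ∧ lookup S′ b))
        ≡⟨ sum-cong-≗ (λ b → trans (cong (λ s → 𝟙 (s ∧ not (lookup S′ b) ∧ adj G x b) + 𝟙 (adj G x b ∧ lookup S′ b))
                                         (lookup∘update x S true))
                                   (split (lookup S′ b) (adj G x b))) ⟩
      ∑[ b < n ] 𝟙 (adj G x b)
        ≡⟨ deg≡∑ x ⟨
      deg G x ∎
      where
      open ≡-Reasoning
      split : ∀ s e → 𝟙 (not s ∧ e) + 𝟙 (e ∧ s) ≡ 𝟙 e
      split true  true  = refl
      split true  false = refl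
      split false true  = refl
      split false false = refl
      degInto-unchanged : degInto S′ x ≡ degInto S x
      degInto-unchanged =
        trans (degInto-insert S x x∉S) (trans (cong (λ e → degInto S x + 𝟙 e) (irrefl G x)) (+-identityʳ _))

    cut-insert : cut S′ + 2 * degInto S x ≡ cut S + deg G x
    cut-insert = begin
      cut S′ + 2 * degInto S x
        ≡⟨ double-split (cut S′) (degInto S x) ⟩
      cut S′ + degInto S x + degInto S x
        ≡⟨ cong (λ c → cut S′ + c + degInto S x) in-column ⟨
      cut S′ + ∑[ a < n ] 𝟙 (lookup S a ∧ adj G a x) + degInto S x
        ≡⟨ cong (_+ degInto S x) (∑-distrib-+ (leavesFrom S′) (λ a → 𝟙 (lookup S a ∧ adj G a x))) ⟨
      ∑F + degInto S x
        ≡⟨ cong (_+ degInto S x) row-sums ⟩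
      cut S + leavesFrom S′ x + degInto S x
        ≡⟨ +-assoc (cut S) _ _ ⟩
      cut S + (leavesFrom S′ x + degInto S x)
        ≡⟨ cong (cut S +_) leavesFrom-inserted ⟩
      cut S + deg G x ∎
      where
      open ≡-Reasoning
      ∑F : ℕ
      ∑F = ∑[ a < n ] (leavesFrom S′ a + 𝟙 (lookup S a ∧ adj G a x))
      double-split : ∀ c d → c + 2 * d ≡ c + d + d
      double-split c d = trans (cong (λ t → c + (d + t)) (+-identityʳ d)) (sym (+-assoc c d d))
      in-column : ∑[ a < n ] 𝟙 (lookup S a ∧ adj G a x) ≡ degInto S x
      in-column = sum-cong-≗ λ a → cong 𝟙 (trans (∧-comm (lookup S a) _) (cong (_∧ lookup S a) (adj-sym G a x)))
      row-sums : ∑F ≡ cut S + leavesFrom S′ x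
      row-sums = begin
        ∑F                                 ≡⟨ +-identityʳ ∑F ⟨
        ∑F + 0                             ≡⟨ cong (∑F +_) leavesFrom-outside ⟨
        ∑F + leavesFrom S x                ≡⟨ ∑-update _ (leavesFrom S) x leavesFrom-insert ⟩
        cut S + (leavesFrom S′ x + 𝟙 (lookup S x ∧ adj G x x))
          ≡⟨ cong (λ s → cut S + (leavesFrom S′ x + 𝟙 (s ∧ adj G x x))) x∉S ⟩
        cut S + (leavesFrom S′ x + 0)      ≡⟨ cong (cut S +_) (+-identityʳ (leavesFrom S′ x)) ⟩
        cut S + leavesFrom S′ x            ∎

  degInto-move : ∀ {S y z} x → lookup S z ≡ true → lookup S y ≡ false →
    degInto (S [ z ]≔ false [ y ]≔ true) x + 𝟙 (adj G x z) ≡ degInto S x + 𝟙 (adj G x y)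
  degInto-move {S} {y} {z} x z∈S y∉S = begin
    degInto (S₁ [ y ]≔ true) x + 𝟙 (adj G x z)     ≡⟨ cong (_+ 𝟙 (adj G x z)) (degInto-insert S₁ x (∉-remove S y∉S z∈S)) ⟩
    degInto S₁ x + 𝟙 (adj G x y) + 𝟙 (adj G x z)   ≡⟨ xy∙z≈xz∙y (degInto S₁ x) _ _ ⟩
    degInto S₁ x + 𝟙 (adj G x z) + 𝟙 (adj G x y)   ≡⟨ cong (_+ 𝟙 (adj G x y)) (degInto-remove S x z∈S) ⟩
    degInto S x + 𝟙 (adj G x y)                    ∎
    where
    open ≡-Reasoning
    S₁ : Subset n
    S₁ = S [ z ]≔ false

-- The degree of a k-set in the k-token graph

module _ {n} (G : Graph n) where

  adj⇒≢ : ∀ {a b} → adj G a b ≡ true → a ≢ b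
  adj⇒≢ {a} e refl = case trans (sym e) (irrefl G a) of λ ()

  leaves⇒ : ∀ {S a b} → leaves G S a b ≡ true → lookup S a ≡ true × lookup S b ≡ false × adj G a b ≡ true
  leaves⇒ {S} {a} {b} eq with lookup S a | lookup S b | adj G a b
  ... | true  | false | true  = refl , refl , refl
  ... | true  | false | false = case eq of λ ()
  ... | true  | true  | _     = case eq of λ ()
  ... | false | _     | _     = case eq of λ ()

  leaves⇐ : ∀ {S a b} → lookup S a ≡ true → lookup S b ≡ false → adj G a b ≡ true → leaves G S a b ≡ true
  leaves⇐ a∈S b∉S e rewrite a∈S | b∉S = e

  leaving-unique : ∀ {A a b a′ b′} → leaves G A a b ≡ true → leaves G A a′ b′ ≡ true →
    A △ (⁅ a ⁆ ∪ ⁅ b ⁆) ≡ A △ (⁅ a′ ⁆ ∪ ⁅ b′ ⁆) → a ≡ a′ × b ≡ b′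
  leaving-unique {A} {a} {b} {a′} {b′} ab ab′ eq
    with leaves⇒ {A} {a} {b} ab | leaves⇒ {A} {a′} {b′} ab′
  ... | a∈A , b∉A , _ | a′∈A , b′∉A , _ =
    [ id , (λ a≡b′ → ⊥-elim (∉-∈⇒≢ A b′∉A a∈A (sym a≡b′))) ]′ (endpoint (inj₁ (x∈⁅x⁆ a))) ,
    [ (λ b≡a′ → ⊥-elim (∉-∈⇒≢ A b∉A a′∈A b≡a′)) , id ]′ (endpoint (inj₂ (x∈⁅x⁆ b)))
    where
    same-pair : ⁅ a ⁆ ∪ ⁅ b ⁆ ≡ ⁅ a′ ⁆ ∪ ⁅ b′ ⁆
    same-pair = trans (sym (△-cancelˡ A _)) (trans (cong (A △_) eq) (△-cancelˡ A _))
    endpoint : ∀ {x} → x ∈ ⁅ a ⁆ ⊎ x ∈ ⁅ b ⁆ → x ≡ a′ ⊎ x ≡ b′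
    endpoint {x} x∈ = ⊎-map (x∈⁅y⁆⇒x≡y a′) (x∈⁅y⁆⇒x≡y b′)
      (x∈p∪q⁻ ⁅ a′ ⁆ ⁅ b′ ⁆ (subst (x ∈_) same-pair (x∈p∪q⁺ {p = ⁅ a ⁆} {q = ⁅ b ⁆} x∈)))

  tokAdj⇒leaving : ∀ {A B} → ∣ B ∣ ≡ ∣ A ∣ → TokAdj G A B →
    ∃₂ λ a b → leaves G A a b ≡ true × B ≡ A △ (⁅ a ⁆ ∪ ⁅ b ⁆)
  tokAdj⇒leaving {A} {B} ∣B∣≡∣A∣ (a , b , ab , A△B≡ab) = orient (lookup A a) (lookup A b) refl refl
    where
    e : adj G a b ≡ true
    e = Equivalence.to T-≡ ab
    B≡ : B ≡ A △ (⁅ a ⁆ ∪ ⁅ b ⁆)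
    B≡ = trans (sym (△-cancelˡ A B)) (cong (A △_) A△B≡ab)
    card : ∀ {x y} → lookup A a ≡ x → lookup A b ≡ y → ∣ A ∣ + (𝟙 x + 𝟙 y) ≡ ∣ A ∣ + (𝟙 (not x) + 𝟙 (not y))
    card refl refl =
      subst (λ c → c + (𝟙 (lookup A a) + 𝟙 (lookup A b)) ≡ ∣ A ∣ + (𝟙 (not (lookup A a)) + 𝟙 (not (lookup A b))))
            (trans (cong ∣_∣ (sym B≡)) ∣B∣≡∣A∣) (∣△-pair∣ A (adj⇒≢ e))
    orient : ∀ x y → lookup A a ≡ x → lookup A b ≡ y → ∃₂ λ a b → leaves G A a b ≡ true × B ≡ A △ (⁅ a ⁆ ∪ ⁅ b ⁆)
    orient true  false a∈A b∉A = a , b , leaves⇐ {A} {a} {b} a∈A b∉A e , B≡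
    orient false true  a∉A b∈A =
      b , a , leaves⇐ {A} {b} {a} b∈A a∉A (trans (adj-sym G b a) e) , trans B≡ (cong (A △_) (∪-comm ⁅ a ⁆ ⁅ b ⁆))
    orient true  true  a∈A b∈A = case +-cancelˡ-≡ ∣ A ∣ 2 0 (card a∈A b∈A) of λ ()
    orient false false a∉A b∉A = case +-cancelˡ-≡ ∣ A ∣ 0 2 (card a∉A b∉A) of λ ()

  leaving⇒tokAdj : ∀ {A a b} → leaves G A a b ≡ true →
    ∣ A △ (⁅ a ⁆ ∪ ⁅ b ⁆) ∣ ≡ ∣ A ∣ × TokAdj G A (A △ (⁅ a ⁆ ∪ ⁅ b ⁆))
  leaving⇒tokAdj {A} {a} {b} ab with leaves⇒ {A} {a} {b} ab
  ... | a∈A , b∉A , e =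
    +-cancelʳ-≡ 1 _ _ (subst₂ (λ x y → ∣ A △ (⁅ a ⁆ ∪ ⁅ b ⁆) ∣ + (𝟙 x + 𝟙 y) ≡ ∣ A ∣ + (𝟙 (not x) + 𝟙 (not y)))
                              a∈A b∉A (∣△-pair∣ A (adj⇒≢ e))) ,
    a , b , Equivalence.from T-≡ e , △-cancelˡ A _

  module _ {k} (A : Subset n) (∣A∣≡k : ∣ A ∣ ≡ k) where

    tokAdj? : ∀ B → Dec (∣ B ∣ ≡ k × TokAdj G A B)
    tokAdj? B = (∣ B ∣ ≟ℕ k) ×-dec TokAdj? G A B

    -- Each neighbour B of A is counted exactly once, through the unique edge leaving A whose ends B swaps.
    pair-term : Subset n → Fin n → Fin n → ℕ
    pair-term B a b = 𝟙 (leaves G A a b) * 𝟙 (does (B ≟ˢ A △ (⁅ a ⁆ ∪ ⁅ b ⁆)))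

    ∑∑pair-term-neighbour : ∀ B → ∣ B ∣ ≡ k × TokAdj G A B → ∑[ a < n ] ∑[ b < n ] pair-term B a b ≡ 1
    ∑∑pair-term-neighbour B (∣B∣≡k , B~A) with tokAdj⇒leaving (trans ∣B∣≡k (sym ∣A∣≡k)) B~A
    ... | a₀ , b₀ , a₀b₀ , refl = trans (∑∑-single _ a₀ b₀ vanishes) value
      where
      vanishes : ∀ a b → ¬ (a ≡ a₀ × b ≡ b₀) → pair-term (A △ (⁅ a₀ ⁆ ∪ ⁅ b₀ ⁆)) a b ≡ 0
      vanishes a b ≢ with leaves G A a b in ab | A △ (⁅ a₀ ⁆ ∪ ⁅ b₀ ⁆) ≟ˢ A △ (⁅ a ⁆ ∪ ⁅ b ⁆)
      ... | true  | yes eq = ⊥-elim (≢ (leaving-unique ab a₀b₀ (sym eq)))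
      ... | true  | no _   = refl
      ... | false | _      = refl
      value : pair-term (A △ (⁅ a₀ ⁆ ∪ ⁅ b₀ ⁆)) a₀ b₀ ≡ 1
      value rewrite a₀b₀ | dec-true (A △ (⁅ a₀ ⁆ ∪ ⁅ b₀ ⁆) ≟ˢ A △ (⁅ a₀ ⁆ ∪ ⁅ b₀ ⁆)) refl = refl

    ∑∑pair-term-non-neighbour : ∀ B → ¬ (∣ B ∣ ≡ k × TokAdj G A B) → ∑[ a < n ] ∑[ b < n ] pair-term B a b ≡ 0
    ∑∑pair-term-non-neighbour B ¬B~A = ∑-zero _ λ a → ∑-zero _ λ b → vanishes a b
      where
      vanishes : ∀ a b → pair-term B a b ≡ 0
      vanishes a b with leaves G A a b in ab | B ≟ˢ A △ (⁅ a ⁆ ∪ ⁅ b ⁆)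
      ... | true  | yes refl = ⊥-elim (¬B~A (map₁ (λ c → trans c ∣A∣≡k) (leaving⇒tokAdj ab)))
      ... | true  | no _     = refl
      ... | false | _        = refl

    tokDeg≡cut : tokDeg G k A ≡ cut G A
    tokDeg≡cut = begin
      tokDeg G k A                                     ≡⟨ length-filter≡sum tokAdj? (allSubsets n) ⟩
      ∑ˢ (λ B → 𝟙 (does (tokAdj? B)))
        ≡⟨ sum-map-cong (λ B → indicator (tokAdj? B) (∑∑pair-term-neighbour B) (∑∑pair-term-non-neighbour B)) (allSubsets n) ⟨
      ∑ˢ (λ B → ∑[ a < n ] ∑[ b < n ] pair-term B a b) ≡⟨ sum-map-∑ (λ B a → ∑[ b < n ] pair-term B a b) (allSubsets n) ⟩
      ∑[ a < n ] ∑ˢ (λ B → ∑[ b < n ] pair-term B a b) ≡⟨ sum-cong-≗ (λ a → sum-map-∑ (λ B → pair-term B a) (allSubsets n)) ⟩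
      ∑[ a < n ] ∑[ b < n ] ∑ˢ (λ B → pair-term B a b) ≡⟨ sum-cong-≗ (λ a → sum-cong-≗ (λ b → pairs-counted a b)) ⟩
      cut G A                                          ∎
      where
      open ≡-Reasoning
      pairs-counted : ∀ a b → ∑ˢ (λ B → pair-term B a b) ≡ 𝟙 (leaves G A a b)
      pairs-counted a b = begin
        ∑ˢ (λ B → pair-term B a b)
          ≡⟨ sum-map-* (𝟙 (leaves G A a b)) (λ B → 𝟙 (does (B ≟ˢ A △ (⁅ a ⁆ ∪ ⁅ b ⁆)))) (allSubsets n) ⟩
        𝟙 (leaves G A a b) * ∑ˢ (λ B → 𝟙 (does (B ≟ˢ A △ (⁅ a ⁆ ∪ ⁅ b ⁆))))
          ≡⟨ cong (𝟙 (leaves G A a b) *_) (∑ˢ-≟ˢ≡1 (A △ (⁅ a ⁆ ∪ ⁅ b ⁆))) ⟩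
        𝟙 (leaves G A a b) * 1
          ≡⟨ *-identityʳ _ ⟩
        𝟙 (leaves G A a b) ∎

-- Consequences of the regularity of F_k(G)

module _ {n} (G : Graph n) {k} (regular : TokenRegular G k) where

  balance : ∀ S u v → suc ∣ S ∣ ≡ k → lookup S u ≡ false → lookup S v ≡ false →
    deg G u + 2 * degInto G S v ≡ deg G v + 2 * degInto G S u
  balance S u v ∣S∣+1≡k u∉S v∉S =
    cross-cancel (cut G S) (proj₁ regular) (deg G u) (deg G v) (2 * degInto G S u) (2 * degInto G S v)
      (cut-after-insert u∉S) (cut-after-insert v∉S)
    where
    cut-after-insert : ∀ {x} → lookup S x ≡ false → cut G S + deg G x ≡ proj₁ regular + 2 * degInto G S x
    cut-after-insert {x} x∉S = begin
      cut G S + deg G x                                  ≡⟨ cut-insert G S x x∉S ⟨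
      cut G A + 2 * degInto G S x                        ≡⟨ cong (_+ 2 * degInto G S x) cut≡r ⟩
      proj₁ regular + 2 * degInto G S x                  ∎
      where
      open ≡-Reasoning
      A : Subset n
      A = S [ x ]≔ true
      ∣A∣≡k : ∣ A ∣ ≡ k
      ∣A∣≡k = trans (∣insert∣ S x∉S) ∣S∣+1≡k
      cut≡r : cut G A ≡ proj₁ regular
      cut≡r = trans (sym (tokDeg≡cut G A ∣A∣≡k)) (proj₂ regular A ∣A∣≡k)

  exchange : ∀ S u v y z → suc ∣ S ∣ ≡ k → lookup S u ≡ false → lookup S v ≡ false →
    lookup S z ≡ true → lookup S y ≡ false → y ≢ u → y ≢ v →
    𝟙 (adj G v y) + 𝟙 (adj G u z) ≡ 𝟙 (adj G u y) + 𝟙 (adj G v z)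
  exchange S u v y z ∣S∣+1≡k u∉S v∉S z∈S y∉S y≢u y≢v = +-cancelˡ-≡ (p + q′) _ _ (begin
    p + q′ + (𝟙 (adj G v y) + 𝟙 (adj G u z))  ≡⟨ interchange p q′ _ _ ⟩
    p + 𝟙 (adj G v y) + (q′ + 𝟙 (adj G u z))
      ≡⟨ cong₂ _+_ (degInto-move G {S} {y} {z} v z∈S y∉S) (sym (degInto-move G {S} {y} {z} u z∈S y∉S)) ⟨
    p′ + 𝟙 (adj G v z) + (q + 𝟙 (adj G u y))  ≡⟨ interchange p′ _ q _ ⟩
    p′ + q + (𝟙 (adj G v z) + 𝟙 (adj G u y))  ≡⟨ cong₂ _+_ same-sums (+-comm (𝟙 (adj G u y)) _) ⟨
    p + q′ + (𝟙 (adj G u y) + 𝟙 (adj G v z))  ∎)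
    where
    open ≡-Reasoning
    S₁ : Subset n
    S₁ = S [ z ]≔ false
    S′ : Subset n
    S′ = S₁ [ y ]≔ true
    p : ℕ
    p = degInto G S v
    q : ℕ
    q = degInto G S u
    p′ : ℕ
    p′ = degInto G S′ v
    q′ : ℕ
    q′ = degInto G S′ u
    ∣S′∣+1≡k : suc ∣ S′ ∣ ≡ k
    ∣S′∣+1≡k = trans (cong suc (trans (∣insert∣ S₁ (∉-remove S y∉S z∈S)) (∣remove∣ S z∈S))) ∣S∣+1≡k
    ∉S′ : ∀ {x} → lookup S x ≡ false → x ≢ y → lookup S′ x ≡ false
    ∉S′ x∉S x≢y = trans (lookup∘update′ x≢y S₁ true) (∉-remove S x∉S z∈S)
    same-sums : p + q′ ≡ p′ + q
    same-sums = *-cancelˡ-≡ _ _ 2 (begin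
      2 * (p + q′)        ≡⟨ *-distribˡ-+ 2 p q′ ⟩
      2 * p + 2 * q′      ≡⟨ cross-cancel (deg G u) (deg G v) (2 * p) (2 * p′) (2 * q) (2 * q′)
                               (balance S u v ∣S∣+1≡k u∉S v∉S)
                               (balance S′ u v ∣S′∣+1≡k (∉S′ u∉S (y≢u ∘ sym)) (∉S′ v∉S (y≢v ∘ sym))) ⟩
      2 * p′ + 2 * q      ≡⟨ *-distribˡ-+ 2 p′ q ⟨
      2 * (p′ + q)        ∎)

no-neighbour-outside : ∀ {n} (G : Graph n) {k} → TokenRegular G k → 2 ≤ k → k ≤ n ∸ 2 →
  ∀ {u v w} → deg G u < deg G v → adj G u w ≡ true → w ≢ u → w ≢ v → ⊥
no-neighbour-outside {n} G {suc (suc m)} regular (s≤s (s≤s z≤n)) k≤n-2 {u} {v} {w} du<dv uw w≢u w≢v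
  with choose-configuration (λ u≡v → <-irrefl (cong (deg G) u≡v) du<dv) w≢u w≢v m k≤n-2
... | T , y , ∣T∣≡1+m , u∉T , v∉T , w∈T , y∉T , y≢u , y≢v =
  <-irrefl (balance G regular T u v (cong suc ∣T∣≡1+m) u∉T v∉T) (+-mono-<-≤ du<dv (*-monoʳ-≤ 2 dv≤du))
  where
  exchange-at : ∀ {z} → lookup T z ≡ true → 𝟙 (adj G v y) + 𝟙 (adj G u z) ≡ 𝟙 (adj G u y) + 𝟙 (adj G v z)
  exchange-at {z} z∈T = exchange G regular T u v y z (cong suc ∣T∣≡1+m) u∉T v∉T z∈T y∉T y≢u y≢v
  dv≤du : degInto G T v ≤ degInto G T u
  dv≤du = ∑-mono-≤ (λ z → 𝟙 (adj G v z ∧ lookup T z)) (λ z → 𝟙 (adj G u z ∧ lookup T z)) pointwise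
    where
    pointwise : ∀ z → 𝟙 (adj G v z ∧ lookup T z) ≤ 𝟙 (adj G u z ∧ lookup T z)
    pointwise z with lookup T z in z∈T
    ... | true  rewrite ∧-identityʳ (adj G v z) | ∧-identityʳ (adj G u z) =
      exchange-≤ (subst (λ b → 𝟙 (adj G v y) + 𝟙 b ≡ 𝟙 (adj G u y) + 𝟙 (adj G v w)) uw (exchange-at w∈T))
                 (𝟙≤1 (adj G v w)) (exchange-at z∈T)
    ... | false rewrite ∧-zeroʳ (adj G v z) | ∧-zeroʳ (adj G u z) = z≤n

lemma4 : (n : ℕ) (G : Graph n) → ¬ Regular G → (u v : Fin n) → deg G u < deg G v
    → (k : ℕ) → 2 ≤ k → k ≤ n ∸ 2 → TokenRegular G k
    → degIn G (λ x → ¬? (x ≟ u) ×-dec ¬? (x ≟ v)) u ≡ 0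
lemma4 n G _ u v du<dv k 2≤k k≤n-2 regular =
  cong length (filter-none (λ x → Adj? G u x ×-dec (¬? (x ≟ u) ×-dec ¬? (x ≟ v)))
                           (universal no-neighbour-in-R (allFin n)))
  where
  no-neighbour-in-R : ∀ w → ¬ (Adj G u w × ¬ w ≡ u × ¬ w ≡ v)
  no-neighbour-in-R w (uw , w≢u , w≢v) =
    no-neighbour-outside G regular 2≤k k≤n-2 du<dv (Equivalence.to T-≡ uw) w≢u w≢v
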